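{- Let $G$ be a non-trivial graph and $n\ge 2$. Then $G\boxtimes K_n$ is a join graph if and only if $G$ is a join graph.
   Context: All graphs are finite and simple; non-trivial means having at least two vertices. The strong product $G\boxtimes H$ has vertex set $V(G)\times V(H)$, with distinct $(g,h),(g',h')$ adjacent iff ($g=g'$ or $gg'\in E(G)$) and ($h=h'$ or $hh'\in E(H)$). The join $G_1\vee G_2$ of disjoint (nonempty) graphs is their disjoint union together with all edges between $V(G_1)$ and $V(G_2)$; a graph is a join graph if it is isomorphic to $G_1\vee G_2$ for some nonempty graphs $G_1,G_2$. -}

module Defs where

open import Data.Nat using (ℕ; _+_; _*_; _≥_)
open import Data.Fin using (Fin; splitAt; remQuot)
open import Data.Bool using (Bool; true; false; _∧_; _∨_; not)
open import Data.Sum using (_⊎_; inj₁; inj₂)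
open import Data.Product using (Σ; _×_; _,_; ∃; proj₁; proj₂)
open import Relation.Binary.PropositionalEquality using (_≡_; _≢_; refl; sym)
open import Data.Empty using (⊥-elim)
open import Function.Bundles using (_⤖_; Bijection)
open import Relation.Nullary using (Dec; yes; no; ¬_)
open import Relation.Nullary.Decidable using (⌊_⌋)
import Data.Fin.Properties as FinP

record Graph : Set where
  field
    V     : ℕ
    adj   : Fin V → Fin V → Bool
    irrefl : ∀ x → adj x x ≡ false
    symm  : ∀ x y → adj x y ≡ adj y x
open Graph public

NonTrivial : Graph → Set
NonTrivial G = V G ≥ 2

NonEmpty : Graph → Set
NonEmpty G = V G ≥ 1

_≅_ : Graph → Graph → Set
G ≅ H = Σ (Fin (V G) ⤖ Fin (V H)) λ f →
          ∀ x y → adj H (Bijection.to f x) (Bijection.to f y) ≡ adj G x y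

K : ℕ → Graph
K n = record
  { V = n
  ; adj = λ x y → not ⌊ x FinP.≟ y ⌋
  ; irrefl = irr
  ; symm = sy }
  where
  irr : ∀ x → not ⌊ x FinP.≟ x ⌋ ≡ false
  irr x with x FinP.≟ x
  ... | yes _ = refl
  ... | no ¬p = ⊥-elim (¬p refl)
  sy : ∀ x y → not ⌊ x FinP.≟ y ⌋ ≡ not ⌊ y FinP.≟ x ⌋
  sy x y with x FinP.≟ y | y FinP.≟ x
  ... | yes _ | yes _ = refl
  ... | no _ | no _ = refl
  ... | yes p | no q = ⊥-elim (q (sym p))
  ... | no p | yes q = ⊥-elim (p (sym q))

joinAdj : (G₁ G₂ : Graph) → Fin (V G₁) ⊎ Fin (V G₂) → Fin (V G₁) ⊎ Fin (V G₂) → Bool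
joinAdj G₁ G₂ (inj₁ x) (inj₁ y) = adj G₁ x y
joinAdj G₁ G₂ (inj₁ x) (inj₂ y) = true
joinAdj G₁ G₂ (inj₂ x) (inj₁ y) = true
joinAdj G₁ G₂ (inj₂ x) (inj₂ y) = adj G₂ x y

_⊻_ : Graph → Graph → Graph
G₁ ⊻ G₂ = record
  { V = V G₁ + V G₂
  ; adj = λ x y → joinAdj G₁ G₂ (splitAt (V G₁) x) (splitAt (V G₁) y)
  ; irrefl = λ x → irr (splitAt (V G₁) x)
  ; symm = λ x y → sy (splitAt (V G₁) x) (splitAt (V G₁) y) }
  where
  irr : ∀ u → joinAdj G₁ G₂ u u ≡ false
  irr (inj₁ x) = irrefl G₁ x
  irr (inj₂ x) = irrefl G₂ x
  sy : ∀ u w → joinAdj G₁ G₂ u w ≡ joinAdj G₁ G₂ w u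
  sy (inj₁ x) (inj₁ y) = symm G₁ x y
  sy (inj₁ x) (inj₂ y) = refl
  sy (inj₂ x) (inj₁ y) = refl
  sy (inj₂ x) (inj₂ y) = symm G₂ x y

IsJoin : Graph → Set
IsJoin G = Σ Graph λ G₁ → Σ Graph λ G₂ → NonEmpty G₁ × NonEmpty G₂ × (G ≅ (G₁ ⊻ G₂))

closedAdj : (G : Graph) → Fin (V G) → Fin (V G) → Bool
closedAdj G x y = ⌊ x FinP.≟ y ⌋ ∨ adj G x y

strongAdj : (G H : Graph) → Fin (V G) × Fin (V H) → Fin (V G) × Fin (V H) → Bool
strongAdj G H (g , h) (g' , h') =
  not (⌊ g FinP.≟ g' ⌋ ∧ ⌊ h FinP.≟ h' ⌋) ∧ (closedAdj G g g' ∧ closedAdj H h h')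


_⊠_ : Graph → Graph → Graph
G ⊠ H = record
  { V = V G * V H
  ; adj = λ x y → strongAdj G H (remQuot (V H) x) (remQuot (V H) y)
  ; irrefl = λ x → irr (remQuot (V H) x)
  ; symm = λ x y → sy (remQuot (V H) x) (remQuot (V H) y) }
  where
  irr : ∀ u → strongAdj G H u u ≡ false
  irr (g , h) with g FinP.≟ g | h FinP.≟ h
  ... | yes _ | yes _ = refl
  ... | no p | _ = ⊥-elim (p refl)
  ... | yes _ | no p = ⊥-elim (p refl)
  eqs : ∀ {n} (a b : Fin n) → ⌊ a FinP.≟ b ⌋ ≡ ⌊ b FinP.≟ a ⌋
  eqs a b with a FinP.≟ b | b FinP.≟ a
  ... | yes _ | yes _ = refl
  ... | no _ | no _ = refl
  ... | yes p | no q = ⊥-elim (q (sym p))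
  ... | no p | yes q = ⊥-elim (p (sym q))
  sy : ∀ u w → strongAdj G H u w ≡ strongAdj G H w u
  sy (g , h) (g' , h')
    rewrite eqs g g' | eqs h h' | symm G g g' | symm H h h' = refl

{-# OPTIONS --safe #-}
-- A graph is a join iff it has a complete cut: a 2-colouring using both colours in which any
-- two differently coloured vertices are adjacent. A complete cut of G lifts to G ⊠ K n by
-- colouring (g , h) like g. Conversely, take a complete cut of G ⊠ H. If every fibre {g} × H
-- is monochromatic, colouring g like (g , h₀) is a complete cut of G. If some fibre {g} × H
-- meets both colours, then every other y has a neighbour of the opposite colour in that fibre,
-- so g is adjacent to all other vertices and, as G has a second vertex, {g} is one side of a
-- complete cut of G.
module Submission where

open import Defs
open import Data.Bool using (Bool; true; false; not; _≟_)
open import Data.Bool.Properties using (∧-conicalˡ; ∨-inverseʳ; not-injective)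
open import Data.Empty using (⊥-elim)
open import Data.Fin using (Fin; zero; suc; splitAt; join; combine; remQuot; fromℕ<; punchIn)
open import Data.Fin.Properties
  using (any?; nonZeroIndex; punchInᵢ≢i; +↔⊎; splitAt-join; remQuot-combine; combine-remQuot)
  renaming (_≟_ to _≟ᶠ_)
open import Data.Nat using (ℕ; zero; suc; _≥_; s≤s; >-nonZero⁻¹)
open import Data.Product using (_,_; proj₁; proj₂; ∃; uncurry)
open import Data.Sum using (_⊎_; inj₁; inj₂; [_,_]; swap)
open import Data.Sum.Algebra using (⊎-assoc; ⊎-comm)
open import Data.Sum.Function.Propositional using (_⊎-↔_)
open import Function using (_∘_; const; case_of_)
open import Function.Bundles using (_⇔_; mk⇔; _↔_; Inverse; Bijection)
open import Function.Properties.Equivalence using () renaming (sym to ⇔-sym; trans to ⇔-trans)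
open import Function.Properties.Inverse using (↔-refl; ↔-sym; ↔-trans; ↔⇒⤖)
open import Relation.Binary.PropositionalEquality
  using (_≡_; _≢_; refl; sym; trans; cong; cong₂; module ≡-Reasoning)
open import Relation.Nullary using (yes; no; ¬?; does)
open import Relation.Nullary.Decidable using (⌊_⌋; dec-true; dec-false; decidable-stable)

isLeft : {A B : Set} → A ⊎ B → Bool
isLeft = [ const true , const false ]

separates⇒≢ : {A : Set} (f : A → Bool) {x y : A} → f x ≡ true → f y ≡ false → x ≢ y
separates⇒≢ f p q refl = case trans (sym p) q of λ ()

≢-either : {p q : Bool} → p ≢ q → (r : Bool) → r ≢ p ⊎ r ≢ q
≢-either {p} p≢q r with r ≟ p
... | yes refl = inj₂ p≢q
... | no r≢p   = inj₁ r≢p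

record CompleteCut (G : Graph) : Set where
  field
    side       : Fin (V G) → Bool
    left       : Fin (V G)
    left-side  : side left ≡ true
    right      : Fin (V G)
    right-side : side right ≡ false
    cross-adj  : ∀ {x y} → side x ≡ true → side y ≡ false → adj G x y ≡ true

module _ {G : Graph} (C : CompleteCut G) where
  open CompleteCut C

  adj-opposite : ∀ {x y} → side x ≢ side y → adj G x y ≡ true
  adj-opposite {x} {y} ne with side x in px | side y in py
  ... | true  | false = cross-adj px py
  ... | false | true  = trans (symm G x y) (cross-adj py px)
  ... | true  | true  = ⊥-elim (ne refl)
  ... | false | false = ⊥-elim (ne refl)

completeCut-≅ : ∀ {G H} → G ≅ H → CompleteCut H → CompleteCut G
completeCut-≅ (f , f-adj) C = record
  { side       = side ∘ to
  ; left       = proj₁ (preimage left-side)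
  ; left-side  = proj₂ (preimage left-side)
  ; right      = proj₁ (preimage right-side)
  ; right-side = proj₂ (preimage right-side)
  ; cross-adj  = λ {x} {y} p q → trans (sym (f-adj x y)) (cross-adj p q)
  }
  where
  open Bijection f using (to; strictlySurjective)
  open CompleteCut C
  preimage : ∀ {y b} → side y ≡ b → ∃ λ x → side (to x) ≡ b
  preimage {y} p = let x , tx≡y = strictlySurjective y in x , trans (cong side tx≡y) p

completeCut-⊻ : ∀ {G₁ G₂} → NonEmpty G₁ → NonEmpty G₂ → CompleteCut (G₁ ⊻ G₂)
completeCut-⊻ {G₁} {G₂} ne₁ ne₂ = record
  { side       = isLeft ∘ splitAt (V G₁)
  ; left       = join (V G₁) (V G₂) (inj₁ (fromℕ< ne₁))
  ; left-side  = cong isLeft (splitAt-join (V G₁) (V G₂) (inj₁ (fromℕ< ne₁)))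
  ; right      = join (V G₁) (V G₂) (inj₂ (fromℕ< ne₂))
  ; right-side = cong isLeft (splitAt-join (V G₁) (V G₂) (inj₂ (fromℕ< ne₂)))
  ; cross-adj  = λ {x} {y} → joinAdj-cross (splitAt (V G₁) x) (splitAt (V G₁) y)
  }
  where
  joinAdj-cross : ∀ u w → isLeft u ≡ true → isLeft w ≡ false → joinAdj G₁ G₂ u w ≡ true
  joinAdj-cross (inj₁ _) (inj₂ _) _  _  = refl
  joinAdj-cross (inj₁ _) (inj₁ _) _  ()
  joinAdj-cross (inj₂ _) _        () _

↔⊎-sucˡ : ∀ {n k m} → Fin n ↔ (Fin k ⊎ Fin m) → Fin (suc n) ↔ (Fin (suc k) ⊎ Fin m)
↔⊎-sucˡ {n} {k} e =
  ↔-trans (+↔⊎ {1} {n}) (↔-trans (↔-refl ⊎-↔ e)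
    (↔-trans (↔-sym (⊎-assoc _ _ _ _)) (↔-sym (+↔⊎ {1} {k}) ⊎-↔ ↔-refl)))

record Partition {n : ℕ} (p : Fin n → Bool) : Set where
  field
    {k m}  : ℕ
    split  : Fin n ↔ (Fin k ⊎ Fin m)
    p-from : ∀ u → p (Inverse.from split u) ≡ isLeft u

partition-sucᵗ : ∀ {n} {p : Fin (suc n) → Bool} → p zero ≡ true →
                 Partition (p ∘ suc) → Partition p
partition-sucᵗ {p = p} p0 P = record { split = ↔⊎-sucˡ split ; p-from = p-from′ }
  where
  open Partition P
  p-from′ : ∀ u → p (Inverse.from (↔⊎-sucˡ split) u) ≡ isLeft u
  p-from′ (inj₁ zero)    = p0
  p-from′ (inj₁ (suc i)) = p-from (inj₁ i)
  p-from′ (inj₂ j)       = p-from (inj₂ j)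

partition-not : ∀ {n} {p : Fin n → Bool} → Partition (not ∘ p) → Partition p
partition-not P = record
  { split  = ↔-trans split (⊎-comm _ _)
  ; p-from = λ u → not-injective (trans (p-from (swap u)) (isLeft-swap u))
  }
  where
  open Partition P
  isLeft-swap : {A B : Set} (u : A ⊎ B) → isLeft (swap u) ≡ not (isLeft u)
  isLeft-swap (inj₁ _) = refl
  isLeft-swap (inj₂ _) = refl

partition : ∀ {n} (p : Fin n → Bool) → Partition p
partition {0} p = record { split = +↔⊎ {0} {0} ; p-from = λ { (inj₁ ()) ; (inj₂ ()) } }
partition {suc n} p with p zero in p0
... | true  = partition-sucᵗ p0 (partition (p ∘ suc))
... | false = partition-not (partition-sucᵗ (cong not p0) (partition (not ∘ p ∘ suc)))

induced : (G : Graph) {k : ℕ} → (Fin k → Fin (V G)) → Graph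
induced G {k} f = record
  { V      = k
  ; adj    = λ i j → adj G (f i) (f j)
  ; irrefl = λ i → irrefl G (f i)
  ; symm   = λ i j → symm G (f i) (f j)
  }

nonEmpty-isLeft : ∀ {k m} (u : Fin k ⊎ Fin m) → isLeft u ≡ true → k ≥ 1
nonEmpty-isLeft (inj₁ i) _ = >-nonZero⁻¹ _ {{nonZeroIndex i}}

nonEmpty-isRight : ∀ {k m} (u : Fin k ⊎ Fin m) → isLeft u ≡ false → m ≥ 1
nonEmpty-isRight (inj₂ j) _ = >-nonZero⁻¹ _ {{nonZeroIndex j}}

completeCut⇒isJoin : ∀ {G} → CompleteCut G → IsJoin G
completeCut⇒isJoin {G} C =
  G₁ , G₂ , nonEmpty-isLeft (to left) (side-to left-side) ,
  nonEmpty-isRight (to right) (side-to right-side) , iso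
  where
  open CompleteCut C
  open Partition (partition side)
  open Inverse split using (to; from; strictlyInverseʳ)
  G₁ G₂ : Graph
  G₁ = induced G (from ∘ inj₁)
  G₂ = induced G (from ∘ inj₂)

  side-to : ∀ {x b} → side x ≡ b → isLeft (to x) ≡ b
  side-to {x} p = trans (sym (p-from (to x))) (trans (cong side (strictlyInverseʳ x)) p)

  joinAdj-from : ∀ u w → joinAdj G₁ G₂ u w ≡ adj G (from u) (from w)
  joinAdj-from (inj₁ i) (inj₁ j) = refl
  joinAdj-from (inj₁ i) (inj₂ j) = sym (cross-adj (p-from (inj₁ i)) (p-from (inj₂ j)))
  joinAdj-from (inj₂ i) (inj₁ j) =
    sym (trans (symm G _ _) (cross-adj (p-from (inj₁ j)) (p-from (inj₂ i))))
  joinAdj-from (inj₂ i) (inj₂ j) = refl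

  iso : G ≅ (G₁ ⊻ G₂)
  iso = ↔⇒⤖ (↔-trans split (↔-sym +↔⊎)) , λ x y → begin
    joinAdj G₁ G₂ (splitAt k (join k m (to x))) (splitAt k (join k m (to y)))
      ≡⟨ cong₂ (joinAdj G₁ G₂) (splitAt-join k m (to x)) (splitAt-join k m (to y)) ⟩
    joinAdj G₁ G₂ (to x) (to y)
      ≡⟨ joinAdj-from (to x) (to y) ⟩
    adj G (from (to x)) (from (to y))
      ≡⟨ cong₂ (adj G) (strictlyInverseʳ x) (strictlyInverseʳ y) ⟩
    adj G x y ∎
    where open ≡-Reasoning

isJoin⇔completeCut : ∀ {G} → IsJoin G ⇔ CompleteCut G
isJoin⇔completeCut =
  mk⇔ (λ (_ , _ , ne₁ , ne₂ , iso) → completeCut-≅ iso (completeCut-⊻ ne₁ ne₂)) completeCut⇒isJoin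

adj-⊠ : ∀ G H g g′ h h′ →
        adj (G ⊠ H) (combine g h) (combine g′ h′) ≡ strongAdj G H (g , h) (g′ , h′)
adj-⊠ G H g g′ h h′ = cong₂ (strongAdj G H) (remQuot-combine g h) (remQuot-combine g′ h′)

strongAdj⇒adj : ∀ G H {g g′ h h′} → g ≢ g′ →
                strongAdj G H (g , h) (g′ , h′) ≡ true → adj G g g′ ≡ true
strongAdj⇒adj G H {g} {g′} g≢g′ e with g ≟ᶠ g′
... | yes g≡g′ = ⊥-elim (g≢g′ g≡g′)
... | no _     = ∧-conicalˡ (adj G g g′) _ e

adj-⊠⇒adj : ∀ G H {g g′ h h′} → g ≢ g′ →
            adj (G ⊠ H) (combine g h) (combine g′ h′) ≡ true → adj G g g′ ≡ true
adj-⊠⇒adj G H {g} {g′} {h} {h′} g≢g′ e =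
  strongAdj⇒adj G H g≢g′ (trans (sym (adj-⊠ G H g g′ h h′)) e)

adj⇒strongAdj-K : ∀ G n {g g′} {h h′ : Fin n} → g ≢ g′ → adj G g g′ ≡ true →
                  strongAdj G (K n) (g , h) (g′ , h′) ≡ true
adj⇒strongAdj-K G n {g} {g′} {h} {h′} g≢g′ a with g ≟ᶠ g′
... | yes g≡g′ = ⊥-elim (g≢g′ g≡g′)
... | no _ rewrite a = ∨-inverseʳ ⌊ h ≟ᶠ h′ ⌋

completeCut-⊠K : ∀ {G n} → Fin n → CompleteCut G → CompleteCut (G ⊠ K n)
completeCut-⊠K {G} {n} h₀ C = record
  { side       = side ∘ proj₁ ∘ remQuot n
  ; left       = combine left h₀
  ; left-side  = trans (cong (side ∘ proj₁) (remQuot-combine left h₀)) left-side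
  ; right      = combine right h₀
  ; right-side = trans (cong (side ∘ proj₁) (remQuot-combine right h₀)) right-side
  ; cross-adj  = λ {z} {w} → cross (remQuot n z) (remQuot n w)
  }
  where
  open CompleteCut C
  cross : ∀ u u′ → side (proj₁ u) ≡ true → side (proj₁ u′) ≡ false → strongAdj G (K n) u u′ ≡ true
  cross (g , _) (g′ , _) p q = adj⇒strongAdj-K G n (separates⇒≢ side p q) (cross-adj p q)

∃-≢ : ∀ {k} → k ≥ 2 → (i : Fin k) → ∃ (_≢ i)
∃-≢ (s≤s (s≤s _)) i = punchIn i zero , punchInᵢ≢i i zero

universal⇒completeCut : ∀ {G g} → NonTrivial G → (∀ y → y ≢ g → adj G g y ≡ true) →
                        CompleteCut G
universal⇒completeCut {G} {g} nt universal = record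
  { side       = λ x → does (x ≟ᶠ g)
  ; left       = g
  ; left-side  = dec-true (g ≟ᶠ g) refl
  ; right      = proj₁ other
  ; right-side = dec-false (_ ≟ᶠ g) (proj₂ other)
  ; cross-adj  = cross
  }
  where
  other : ∃ (_≢ g)
  other = ∃-≢ nt g
  cross : ∀ {x y} → does (x ≟ᶠ g) ≡ true → does (y ≟ᶠ g) ≡ false → adj G x y ≡ true
  cross {x} {y} p q with x ≟ᶠ g | y ≟ᶠ g
  ... | yes refl | no y≢g = universal y y≢g

module _ {G H : Graph} (C : CompleteCut (G ⊠ H)) where
  open CompleteCut C

  side⊠ : Fin (V G) → Fin (V H) → Bool
  side⊠ g h = side (combine g h)

  split-fibre⇒universal : ∀ {g a b} → side⊠ g a ≢ side⊠ g b →
                          ∀ y → y ≢ g → adj G g y ≡ true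
  split-fibre⇒universal {g} {a} split y y≢g with ≢-either split (side⊠ y a)
  ... | inj₁ ne = adj-⊠⇒adj G H (y≢g ∘ sym) (adj-opposite C (ne ∘ sym))
  ... | inj₂ ne = adj-⊠⇒adj G H (y≢g ∘ sym) (adj-opposite C (ne ∘ sym))

  constant-fibres⇒completeCut : (h₀ : Fin (V H)) → (∀ g h → side⊠ g h ≡ side⊠ g h₀) →
                                CompleteCut G
  constant-fibres⇒completeCut h₀ constant = record
    { side       = side₀
    ; left       = proj₁ (remQuot {V G} (V H) left)
    ; left-side  = trans (sym (fibre-side left)) left-side
    ; right      = proj₁ (remQuot {V G} (V H) right)
    ; right-side = trans (sym (fibre-side right)) right-side
    ; cross-adj  = λ p q → adj-⊠⇒adj G H (separates⇒≢ side₀ p q) (cross-adj p q)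
    }
    where
    side₀ : Fin (V G) → Bool
    side₀ g = side⊠ g h₀
    fibre-side : ∀ z → side z ≡ side₀ (proj₁ (remQuot {V G} (V H) z))
    fibre-side z = trans (cong side (sym (combine-remQuot {V G} (V H) z)))
                         (uncurry constant (remQuot {V G} (V H) z))

  completeCut-⊠⁻¹ : NonTrivial G → Fin (V H) → CompleteCut G
  completeCut-⊠⁻¹ nt h₀ with any? (λ g → any? (λ h → ¬? (side⊠ g h ≟ side⊠ g h₀)))
  ... | yes (_ , _ , split) = universal⇒completeCut nt (split-fibre⇒universal split)
  ... | no unsplit          = constant-fibres⇒completeCut h₀ λ g h →
    decidable-stable (_ ≟ _) λ ne → unsplit (g , h , ne)

completeCut-⊠K⇔ : ∀ {G n} → NonTrivial G → Fin n → CompleteCut (G ⊠ K n) ⇔ CompleteCut G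
completeCut-⊠K⇔ {G} {n} nt h₀ = mk⇔ (λ C → completeCut-⊠⁻¹ {G} {K n} C nt h₀) (completeCut-⊠K h₀)

-- The hypothesis n ≥ 2 is only used to rule out n = 0.
proposition4p6 : (G : Graph) → NonTrivial G → (n : ℕ) → n ≥ 2 →
                 IsJoin (G ⊠ K n) ⇔ IsJoin G
proposition4p6 G nt zero    ()
proposition4p6 G nt (suc n) _  =
  ⇔-trans (isJoin⇔completeCut {G ⊠ K (suc n)})
    (⇔-trans (completeCut-⊠K⇔ nt zero) (⇔-sym isJoin⇔completeCut))
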